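{- For a feasible packing LP $\mathcal{L}$ and every threshold $\tau \ge \frac{\mathrm{OPT}(\mathcal{L})}{\min_i b_i}$, we have $\mathrm{OPT}(\mathrm{skim}_\tau(\mathcal{L})) + \sum_{t : \pi_t > \tau} \pi_t = \mathrm{OPT}(\mathcal{L})$.
   Context: Consider a packing LP $\mathcal{L}$ of the form $\max\{\sum_{t=1}^n \pi_t x_t : Ax \le b,\ x \in [0,1]^n\}$ with non-negative $\pi, A, b$, where $A$ has columns $A^1,\dots,A^n$; after scaling, all entries of each column $A^t$ lie in $[0,1]$. $\mathrm{OPT}(\cdot)$ denotes the optimal value of an LP. For a threshold $\tau \ge 0$, let $H=\{t : \pi_t > \tau\}$ be the high-value items; the skimmed LP $\mathrm{skim}_\tau(\mathcal{L})$ is obtained from $\mathcal{L}$ by setting to zero the value $\pi_t$ of all items $t \in H$ and replacing the right-hand side by $b - \sum_{t \in H} A^t$ (i.e., the residual LP after fixing $x_t = 1$ for all $t \in H$).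
   Formalization: The values π, the matrix A, the right-hand side b and the threshold τ are rational, and the variables x defining feasibility and OPT take values in ℚ. -}

module Defs where

open import Data.Nat using (ℕ; suc)
open import Data.Fin using (Fin; zero; suc)
open import Data.Bool using (Bool; if_then_else_)
open import Data.Product using (_×_; Σ)
open import Data.Rational using (ℚ; 0ℚ; 1ℚ; _+_; _*_; _-_; _≤_; _<_; _⊓_)
open import Data.Rational.Properties using (_<?_)
open import Relation.Nullary using (does)
open import Relation.Binary.PropositionalEquality using (_≡_)

sumFin : (n : ℕ) → (Fin n → ℚ) → ℚ
sumFin ℕ.zero    f = 0ℚ
sumFin (suc n) f = f zero + sumFin n (λ t → f (suc t))

minFin : (k : ℕ) → (Fin (suc k) → ℚ) → ℚ
minFin ℕ.zero    b = b zero
minFin (suc k) b = b zero ⊓ minFin k (λ i → b (suc i))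

-- A packing LP  max { π·x : A x ≤ b, x ∈ [0,1]^n }  with m constraints, n items
record PackingLP (m n : ℕ) : Set where
  field
    π : Fin n → ℚ
    A : Fin m → Fin n → ℚ      -- A i t : entry in row i of column A^t
    b : Fin m → ℚ

open PackingLP public

WellFormed : ∀ {m n} → PackingLP m n → Set
WellFormed {m} {n} L =
  (∀ t → 0ℚ ≤ π L t) ×
  (∀ i t → 0ℚ ≤ A L i t × A L i t ≤ 1ℚ) ×
  (∀ i → 0ℚ ≤ b L i)

Feasible : ∀ {m n} → PackingLP m n → (Fin n → ℚ) → Set
Feasible {m} {n} L x =
  (∀ t → 0ℚ ≤ x t × x t ≤ 1ℚ) ×
  (∀ i → sumFin n (λ t → A L i t * x t) ≤ b L i)

objective : ∀ {m n} → PackingLP m n → (Fin n → ℚ) → ℚ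
objective {m} {n} L x = sumFin n (λ t → π L t * x t)

IsOPT : ∀ {m n} → PackingLP m n → ℚ → Set
IsOPT {m} {n} L v =
  Σ (Fin n → ℚ) (λ x → Feasible L x × objective L x ≡ v) ×
  (∀ x → Feasible L x → objective L x ≤ v)

isHigh : ∀ {m n} → ℚ → PackingLP m n → Fin n → Bool
isHigh τ L t = does (τ <? π L t)

highValue : ∀ {m n} → ℚ → PackingLP m n → ℚ
highValue {m} {n} τ L = sumFin n (λ t → if isHigh τ L t then π L t else 0ℚ)

skim : ∀ {m n} → ℚ → PackingLP m n → PackingLP m n
skim {m} {n} τ L = record
  { π = λ t → if isHigh τ L t then 0ℚ else π L t
  ; A = A L
  ; b = λ i → b L i - sumFin n (λ t → if isHigh τ L t then A L i t else 0ℚ)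
  }

-- An optimal x saturates every high item: if x_t < 1 with π_t > τ, raise x_t to 1 and scale
-- the whole vector by β / (β + 1 - x_t), where β = min_i b_i. Since column entries are at most 1,
-- the raise adds at most 1 - x_t to each row, which the scaling absorbs because b_i ≥ β; and the
-- new objective exceeds OPT because β π_t > β τ ≥ OPT. Once the high items sit at 1 in an
-- optimum, zeroing them gives a feasible point of the skimmed LP, and setting them to 1 in any
-- feasible point of the skimmed LP gives one of L; both maps shift the objective by Σ_{t∈H} π_t.

module Submission where

open import Defs
open import Data.Nat using (ℕ; suc)
open import Data.Fin using (Fin; zero; suc)
open import Data.Bool using (Bool; true; false; if_then_else_; T)
open import Data.Unit using (tt)
open import Data.Product using (_×_; _,_; proj₁; proj₂; Σ)
open import Data.Sum using (_⊎_; inj₁; inj₂)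
open import Data.Rational
  using (ℚ; 0ℚ; 1ℚ; _+_; _*_; _-_; -_; _≤_; _<_; 1/_; Positive; NonZero; positive; nonNegative)
open import Data.Rational.Properties
open import Data.Rational.Solver using (module +-*-Solver)
open import Algebra.Bundles using (CommutativeRing)
open import Algebra.Properties.Semiring.Sum (CommutativeRing.semiring +-*-commutativeRing)
  using (sum; ∑-distrib-+; *-distribˡ-sum)
open import Relation.Nullary using (¬_)
open import Relation.Nullary.Decidable using (toWitness; isYes≗does)
open import Relation.Binary.PropositionalEquality

open +-*-Solver

InUnitInterval : ℚ → Set
InUnitInterval p = 0ℚ ≤ p × p ≤ 1ℚ

0≤1 : 0ℚ ≤ 1ℚ
0≤1 = <⇒≤ (positive⁻¹ 1ℚ)

0≤p⇒0≤q⇒0≤p*q : ∀ {p q} → 0ℚ ≤ p → 0ℚ ≤ q → 0ℚ ≤ p * q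
0≤p⇒0≤q⇒0≤p*q {p} {q} 0≤p 0≤q =
  nonNegative⁻¹ (p * q) {{nonNeg*nonNeg⇒nonNeg p {{nonNegative 0≤p}} q {{nonNegative 0≤q}}}}

*-unitInterval : ∀ {p q} → InUnitInterval p → InUnitInterval q → InUnitInterval (p * q)
*-unitInterval {p} {q} (0≤p , p≤1) (0≤q , q≤1) =
  0≤p⇒0≤q⇒0≤p*q 0≤p 0≤q ,
  ≤-trans (*-monoˡ-≤-nonNeg p {{nonNegative 0≤p}} q≤1) (≤-trans (≤-reflexive (*-identityʳ p)) p≤1)

p+q≤r⇒q≤r-p : ∀ p q r → p + q ≤ r → q ≤ r - p
p+q≤r⇒q≤r-p p q r p+q≤r =
  subst (_≤ r - p) (solve 2 (λ p q → (p :+ q) :- p := q) refl p q) (+-monoˡ-≤ (- p) p+q≤r)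

q≤r-p⇒p+q≤r : ∀ p q r → q ≤ r - p → p + q ≤ r
q≤r-p⇒p+q≤r p q r q≤r-p =
  subst (p + q ≤_) (solve 2 (λ p r → p :+ (r :- p) := r) refl p r) (+-monoʳ-≤ p q≤r-p)

p+q≡r⇒q≡r-p : ∀ p q r → p + q ≡ r → q ≡ r - p
p+q≡r⇒q≡r-p p q r p+q≡r =
  trans (sym (solve 2 (λ p q → (p :+ q) :- p := q) refl p q)) (cong (_- p) p+q≡r)

-- Division by s is phrased through an inverse r of s, which spares these lemmas the NonZero
-- instance of 1/_.
s*r≡1⇒p*r*s≡p : ∀ p {r} s → s * r ≡ 1ℚ → p * r * s ≡ p
s*r≡1⇒p*r*s≡p p {r} s s*r≡1 = begin
  p * r * s   ≡⟨ solve 3 (λ p r s → p :* r :* s := p :* (s :* r)) refl p r s ⟩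
  p * (s * r) ≡⟨ cong (p *_) s*r≡1 ⟩
  p * 1ℚ      ≡⟨ *-identityʳ p ⟩
  p           ∎
  where open ≡-Reasoning

p≤q*s⇒p*r≤q : ∀ {p q r} s .{{_ : Positive s}} → s * r ≡ 1ℚ → p ≤ q * s → p * r ≤ q
p≤q*s⇒p*r≤q {p} {q} s s*r≡1 p≤q*s =
  *-cancelʳ-≤-pos s (subst (_≤ q * s) (sym (s*r≡1⇒p*r*s≡p p s s*r≡1)) p≤q*s)

q*s<p⇒q<p*r : ∀ {p q r} s .{{_ : Positive s}} → s * r ≡ 1ℚ → q * s < p → q < p * r
q*s<p⇒q<p*r {p} {q} s s*r≡1 q*s<p =
  *-cancelʳ-<-nonNeg s {{pos⇒nonNeg s}} (subst (q * s <_) (sym (s*r≡1⇒p*r*s≡p p s s*r≡1)) q*s<p)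

sumFin≡sum : ∀ n (f : Fin n → ℚ) → sumFin n f ≡ sum f
sumFin≡sum ℕ.zero    f = refl
sumFin≡sum (suc n) f = cong (f zero +_) (sumFin≡sum n (λ t → f (suc t)))

sumFin-cong : ∀ n {f g : Fin n → ℚ} → (∀ t → f t ≡ g t) → sumFin n f ≡ sumFin n g
sumFin-cong ℕ.zero    f≗g = refl
sumFin-cong (suc n) f≗g = cong₂ _+_ (f≗g zero) (sumFin-cong n (λ t → f≗g (suc t)))

sumFin-mono-≤ : ∀ n {f g : Fin n → ℚ} → (∀ t → f t ≤ g t) → sumFin n f ≤ sumFin n g
sumFin-mono-≤ ℕ.zero    f≤g = ≤-refl
sumFin-mono-≤ (suc n) f≤g = +-mono-≤ (f≤g zero) (sumFin-mono-≤ n (λ t → f≤g (suc t)))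

sumFin-distrib-+ : ∀ n (f g : Fin n → ℚ) →
  sumFin n (λ t → f t + g t) ≡ sumFin n f + sumFin n g
sumFin-distrib-+ n f g = begin
  sumFin n (λ t → f t + g t)  ≡⟨ sumFin≡sum n _ ⟩
  sum (λ t → f t + g t)       ≡⟨ ∑-distrib-+ f g ⟩
  sum f + sum g               ≡⟨ sym (cong₂ _+_ (sumFin≡sum n f) (sumFin≡sum n g)) ⟩
  sumFin n f + sumFin n g     ∎
  where open ≡-Reasoning

*-distribˡ-sumFin : ∀ n c (f : Fin n → ℚ) → c * sumFin n f ≡ sumFin n (λ t → c * f t)
*-distribˡ-sumFin n c f = begin
  c * sumFin n f              ≡⟨ cong (c *_) (sumFin≡sum n f) ⟩
  c * sum f                   ≡⟨ *-distribˡ-sum c f ⟩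
  sum (λ t → c * f t)         ≡⟨ sym (sumFin≡sum n _) ⟩
  sumFin n (λ t → c * f t)    ∎
  where open ≡-Reasoning

δ : ∀ {n} → Fin n → Fin n → ℚ
δ zero    zero    = 1ℚ
δ zero    (suc _) = 0ℚ
δ (suc _) zero    = 0ℚ
δ (suc t) (suc u) = δ t u

sumFin-*δ : ∀ n (f : Fin n → ℚ) t → sumFin n (λ u → f u * δ t u) ≡ f t
sumFin-*δ (suc n) f zero = begin
  f zero * 1ℚ + sumFin n (λ u → f (suc u) * 0ℚ)  ≡⟨ cong₂ _+_ (*-identityʳ (f zero)) (sumFin-cong n (λ u → *-zeroʳ (f (suc u)))) ⟩
  f zero + sumFin n (λ _ → 0ℚ)                  ≡⟨ cong (f zero +_) (sumFin-zero n) ⟩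
  f zero + 0ℚ                                  ≡⟨ +-identityʳ (f zero) ⟩
  f zero                                       ∎
  where
  open ≡-Reasoning
  sumFin-zero : ∀ n → sumFin n (λ _ → 0ℚ) ≡ 0ℚ
  sumFin-zero ℕ.zero    = refl
  sumFin-zero (suc n) = trans (+-identityˡ _) (sumFin-zero n)
sumFin-*δ (suc n) f (suc t) =
  trans (cong₂ _+_ (*-zeroʳ (f zero)) (sumFin-*δ n (λ u → f (suc u)) t)) (+-identityˡ (f (suc t)))

minFin-≤ : ∀ k (b : Fin (suc k) → ℚ) i → minFin k b ≤ b i
minFin-≤ ℕ.zero    b zero    = ≤-refl
minFin-≤ (suc k) b zero    = p⊓q≤p _ _
minFin-≤ (suc k) b (suc i) = p≤q⇒r⊓p≤q (b zero) (minFin-≤ k (λ j → b (suc j)) i)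

minFin-attained : ∀ k (b : Fin (suc k) → ℚ) → Σ (Fin (suc k)) (λ i → minFin k b ≡ b i)
minFin-attained ℕ.zero    b = zero , refl
minFin-attained (suc k) b with ⊓-sel (b zero) (minFin k (λ j → b (suc j)))
... | inj₁ eq = zero , eq
... | inj₂ eq with minFin-attained k (λ j → b (suc j))
...   | i , eqᵢ = suc i , trans eq eqᵢ

raise : ∀ {n} → Fin n → (Fin n → ℚ) → Fin n → ℚ
raise t x u = x u + (1ℚ - x t) * δ t u

raise-cases : ∀ {n} (t u : Fin n) (x : Fin n → ℚ) → raise t x u ≡ x u ⊎ raise t x u ≡ 1ℚ
raise-cases zero    zero    x = inj₂ (solve 1 (λ a → a :+ (con 1ℚ :- a) :* con 1ℚ := con 1ℚ) refl (x zero))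
raise-cases zero    (suc u) x = inj₁ (trans (cong (x (suc u) +_) (*-zeroʳ (1ℚ - x zero))) (+-identityʳ (x (suc u))))
raise-cases (suc t) zero    x = inj₁ (trans (cong (x zero +_) (*-zeroʳ (1ℚ - x (suc t)))) (+-identityʳ (x zero)))
raise-cases (suc t) (suc u) x = raise-cases t u (λ v → x (suc v))

raise-unitInterval : ∀ {n} t (x : Fin n → ℚ) → (∀ u → InUnitInterval (x u)) →
  ∀ u → InUnitInterval (raise t x u)
raise-unitInterval t x x∈I u with raise-cases t u x
... | inj₁ eq = subst InUnitInterval (sym eq) (x∈I u)
... | inj₂ eq = subst InUnitInterval (sym eq) (0≤1 , ≤-refl)

sumFin-*raise : ∀ n t (f x : Fin n → ℚ) →
  sumFin n (λ u → f u * raise t x u) ≡ sumFin n (λ u → f u * x u) + (1ℚ - x t) * f t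
sumFin-*raise n t f x = begin
  sumFin n (λ u → f u * raise t x u)
    ≡⟨ sumFin-cong n (λ u → solve 4 (λ F X D E → F :* (X :+ D :* E) := F :* X :+ D :* (F :* E)) refl (f u) (x u) d (δ t u)) ⟩
  sumFin n (λ u → f u * x u + d * (f u * δ t u))
    ≡⟨ sumFin-distrib-+ n _ _ ⟩
  sumFin n (λ u → f u * x u) + sumFin n (λ u → d * (f u * δ t u))
    ≡⟨ cong (sumFin n (λ u → f u * x u) +_) (sym (*-distribˡ-sumFin n d _)) ⟩
  sumFin n (λ u → f u * x u) + d * sumFin n (λ u → f u * δ t u)
    ≡⟨ cong (λ s → sumFin n (λ u → f u * x u) + d * s) (sumFin-*δ n f t) ⟩
  sumFin n (λ u → f u * x u) + d * f t
    ∎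
  where
  open ≡-Reasoning
  d = 1ℚ - x t

unsaturated⇒improvable : ∀ {m n} (L : PackingLP m n) → (∀ i t → A L i t ≤ 1ℚ) →
  ∀ β → 0ℚ < β → (∀ i → β ≤ b L i) →
  ∀ {x} → Feasible L x → ∀ t → x t < 1ℚ → objective L x < β * π L t →
  Σ (Fin n → ℚ) (λ y → Feasible L y × objective L x < objective L y)
unsaturated⇒improvable {m} {n} L A≤1 β 0<β β≤b {x} (x∈I , x-rows) t xₜ<1 obj<βπₜ =
  y , (y∈I , y-rows) , obj<obj-y
  where
  open ≤-Reasoning
  d = 1ℚ - x t
  0<d : 0ℚ < d
  0<d = subst (_< d) (+-inverseʳ (x t)) (+-monoˡ-< (- x t) xₜ<1)
  s = β + d
  instance
    β-pos : Positive β
    β-pos = positive 0<β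
    d-pos : Positive d
    d-pos = positive 0<d
    s-pos : Positive s
    s-pos = positive (+-mono-< 0<β 0<d)
    s-nonZero : NonZero s
    s-nonZero = pos⇒nonZero s
  r = 1/ s
  s*r≡1 : s * r ≡ 1ℚ
  s*r≡1 = *-inverseʳ s
  c = β * r
  y : Fin n → ℚ
  y u = c * raise t x u

  c∈I : InUnitInterval c
  c∈I = nonNegative⁻¹ c {{nonNeg*nonNeg⇒nonNeg β {{pos⇒nonNeg β}} r {{pos⇒nonNeg r {{1/pos⇒pos s}}}}}} ,
        p≤q*s⇒p*r≤q s s*r≡1 (begin
          β         ≡⟨ sym (+-identityʳ β) ⟩
          β + 0ℚ    ≤⟨ +-monoʳ-≤ β (<⇒≤ 0<d) ⟩
          s         ≡⟨ sym (*-identityˡ s) ⟩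
          1ℚ * s    ∎)

  y∈I : ∀ u → InUnitInterval (y u)
  y∈I u = *-unitInterval c∈I (raise-unitInterval t x x∈I u)

  sumFin-*y : ∀ f → sumFin n (λ u → f u * y u) ≡ β * (sumFin n (λ u → f u * x u) + d * f t) * r
  sumFin-*y f = begin-equality
    sumFin n (λ u → f u * y u)
      ≡⟨ sumFin-cong n (λ u → solve 3 (λ F C R → F :* (C :* R) := C :* (F :* R)) refl (f u) c (raise t x u)) ⟩
    sumFin n (λ u → c * (f u * raise t x u))
      ≡⟨ sym (*-distribˡ-sumFin n c _) ⟩
    c * sumFin n (λ u → f u * raise t x u)
      ≡⟨ cong (c *_) (sumFin-*raise n t f x) ⟩
    β * r * (sumFin n (λ u → f u * x u) + d * f t)
      ≡⟨ solve 3 (λ B R X → B :* R :* X := B :* X :* R) refl β r _ ⟩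
    β * (sumFin n (λ u → f u * x u) + d * f t) * r
      ∎

  y-rows : ∀ i → sumFin n (λ u → A L i u * y u) ≤ b L i
  y-rows i = subst (_≤ b L i) (sym (sumFin-*y (A L i))) (p≤q*s⇒p*r≤q s s*r≡1 (begin
    β * (sumFin n (λ u → A L i u * x u) + d * A L i t)
      ≤⟨ *-monoˡ-≤-nonNeg β {{pos⇒nonNeg β}} (+-mono-≤ (x-rows i) (d*Aᵢₜ≤d)) ⟩
    β * (b L i + d)
      ≡⟨ *-distribˡ-+ β (b L i) d ⟩
    β * b L i + β * d
      ≤⟨ +-monoʳ-≤ (β * b L i) (*-monoʳ-≤-nonNeg d {{pos⇒nonNeg d}} (β≤b i)) ⟩
    β * b L i + b L i * d
      ≡⟨ solve 3 (λ B Bi D → B :* Bi :+ Bi :* D := Bi :* (B :+ D)) refl β (b L i) d ⟩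
    b L i * s
      ∎))
    where
    d*Aᵢₜ≤d : d * A L i t ≤ d
    d*Aᵢₜ≤d = ≤-trans (*-monoˡ-≤-nonNeg d {{pos⇒nonNeg d}} (A≤1 i t)) (≤-reflexive (*-identityʳ d))

  obj<obj-y : objective L x < objective L y
  obj<obj-y = subst (objective L x <_) (sym (sumFin-*y (π L))) (q*s<p⇒q<p*r s s*r≡1 (begin-strict
    o * s
      ≡⟨ solve 3 (λ O B D → O :* (B :+ D) := B :* O :+ D :* O) refl o β d ⟩
    β * o + d * o
      <⟨ +-monoʳ-< (β * o) (*-monoʳ-<-pos d obj<βπₜ) ⟩
    β * o + d * (β * π L t)
      ≡⟨ solve 4 (λ O B D P → B :* O :+ D :* (B :* P) := B :* (O :+ D :* P)) refl o β d (π L t) ⟩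
    β * (o + d * π L t)
      ∎))
    where o = objective L x

optimal⇒saturated : ∀ {m n} (L : PackingLP m n) → (∀ i t → A L i t ≤ 1ℚ) →
  ∀ β → 0ℚ < β → (∀ i → β ≤ b L i) →
  ∀ {opt} (opt-L : IsOPT L opt) → ∀ t → opt < β * π L t → proj₁ (proj₁ opt-L) t ≡ 1ℚ
optimal⇒saturated L A≤1 β 0<β β≤b ((x , x-feasible , obj≡opt) , opt-max) t opt<βπₜ =
  ≤-antisym (proj₂ (proj₁ x-feasible t)) (≮⇒≥ xₜ≮1)
  where
  xₜ≮1 : ¬ x t < 1ℚ
  xₜ≮1 xₜ<1 =
    let (y , y-feasible , obj<obj-y) = unsaturated⇒improvable L A≤1 β 0<β β≤b x-feasible t xₜ<1
                                         (subst (_< β * π L t) (sym obj≡opt) opt<βπₜ)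
    in <-irrefl obj≡opt (<-≤-trans obj<obj-y (opt-max y y-feasible))

saturate clear : ∀ {n} → (Fin n → Bool) → (Fin n → ℚ) → Fin n → ℚ
saturate H x t = if H t then 1ℚ else x t
clear    H x t = if H t then 0ℚ else x t

*-saturate : ∀ h a x → a * (if h then 1ℚ else x) ≡ (if h then a else 0ℚ) + a * (if h then 0ℚ else x)
*-saturate true  a x = trans (*-identityʳ a) (sym (trans (cong (a +_) (*-zeroʳ a)) (+-identityʳ a)))
*-saturate false a x = sym (+-identityˡ (a * x))

*-clear-≤ : ∀ h a x → 0ℚ ≤ a * x → a * (if h then 0ℚ else x) ≤ a * x
*-clear-≤ true  a x 0≤a*x = subst (_≤ a * x) (sym (*-zeroʳ a)) 0≤a*x
*-clear-≤ false a x _     = ≤-refl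

clear-*-comm : ∀ h a x → (if h then 0ℚ else a) * x ≡ a * (if h then 0ℚ else x)
clear-*-comm true  a x = trans (*-zeroˡ x) (sym (*-zeroʳ a))
clear-*-comm false a x = refl

saturate-fixed : ∀ h x → (T h → x ≡ 1ℚ) → (if h then 1ℚ else x) ≡ x
saturate-fixed true  x x≡1 = sym (x≡1 tt)
saturate-fixed false x _   = refl

saturate-clear : ∀ h x → (if h then 1ℚ else (if h then 0ℚ else x)) ≡ (if h then 1ℚ else x)
saturate-clear true  x = refl
saturate-clear false x = refl

if-unitInterval : ∀ h {p x} → InUnitInterval p → InUnitInterval x → InUnitInterval (if h then p else x)
if-unitInterval true  p∈I _   = p∈I
if-unitInterval false _   x∈I = x∈I

sumFin-*saturate : ∀ n H (a x : Fin n → ℚ) →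
  sumFin n (λ t → a t * saturate H x t) ≡
  sumFin n (λ t → if H t then a t else 0ℚ) + sumFin n (λ t → a t * clear H x t)
sumFin-*saturate n H a x =
  trans (sumFin-cong n (λ t → *-saturate (H t) (a t) (x t))) (sumFin-distrib-+ n _ _)

objective-saturate : ∀ {m n} τ (L : PackingLP m n) y →
  objective L (saturate (isHigh τ L) y) ≡ highValue τ L + objective (skim τ L) y
objective-saturate {n = n} τ L y =
  trans (sumFin-*saturate n H (π L) y)
        (cong (highValue τ L +_) (sumFin-cong n (λ t → sym (clear-*-comm (H t) (π L t) (y t)))))
  where H = isHigh τ L

IsOPT-skim : ∀ {m n} (L : PackingLP m n) τ → (∀ i t → 0ℚ ≤ A L i t) →
  ∀ {opt} (opt-L : IsOPT L opt) → (∀ t → T (isHigh τ L t) → proj₁ (proj₁ opt-L) t ≡ 1ℚ) →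
  IsOPT (skim τ L) (opt - highValue τ L)
IsOPT-skim {m} {n} L τ 0≤A {opt} ((x , (x∈I , x-rows) , obj≡opt) , opt-max) x-saturated =
  (clear H x , (cleared∈I , cleared-rows) , cleared-obj) , skim-max
  where
  H = isHigh τ L
  highCol : Fin m → ℚ
  highCol i = sumFin n (λ t → if H t then A L i t else 0ℚ)

  cleared∈I : ∀ t → InUnitInterval (clear H x t)
  cleared∈I t = if-unitInterval (H t) (≤-refl , 0≤1) (x∈I t)

  cleared-rows : ∀ i → sumFin n (λ t → A L i t * clear H x t) ≤ b L i - highCol i
  cleared-rows i = p+q≤r⇒q≤r-p _ _ _ (subst (_≤ b L i) (begin
    sumFin n (λ t → A L i t * x t)               ≡⟨ sumFin-cong n (λ t → cong (A L i t *_) (sym (saturate-fixed (H t) (x t) (x-saturated t)))) ⟩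
    sumFin n (λ t → A L i t * saturate H x t)    ≡⟨ sumFin-*saturate n H (A L i) x ⟩
    highCol i + sumFin n (λ t → A L i t * clear H x t) ∎) (x-rows i))
    where open ≡-Reasoning

  cleared-obj : objective (skim τ L) (clear H x) ≡ opt - highValue τ L
  cleared-obj = p+q≡r⇒q≡r-p _ _ _ (begin
    highValue τ L + objective (skim τ L) (clear H x)  ≡⟨ sym (objective-saturate τ L (clear H x)) ⟩
    objective L (saturate H (clear H x))              ≡⟨ sumFin-cong n (λ t → cong (π L t *_) (resaturate t)) ⟩
    objective L x                                     ≡⟨ obj≡opt ⟩
    opt                                               ∎)
    where
    open ≡-Reasoning
    resaturate : ∀ t → saturate H (clear H x) t ≡ x t
    resaturate t = trans (saturate-clear (H t) (x t)) (saturate-fixed (H t) (x t) (x-saturated t))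

  skim-max : ∀ y → Feasible (skim τ L) y → objective (skim τ L) y ≤ opt - highValue τ L
  skim-max y (y∈I , y-rows) =
    p+q≤r⇒q≤r-p _ _ _ (subst (_≤ opt) (objective-saturate τ L y) (opt-max (saturate H y) (saturated∈I , saturated-rows)))
    where
    open ≤-Reasoning
    saturated∈I : ∀ t → InUnitInterval (saturate H y t)
    saturated∈I t = if-unitInterval (H t) (0≤1 , ≤-refl) (y∈I t)

    saturated-rows : ∀ i → sumFin n (λ t → A L i t * saturate H y t) ≤ b L i
    saturated-rows i = begin
      sumFin n (λ t → A L i t * saturate H y t)           ≡⟨ sumFin-*saturate n H (A L i) y ⟩
      highCol i + sumFin n (λ t → A L i t * clear H y t)  ≤⟨ +-monoʳ-≤ (highCol i) (sumFin-mono-≤ n (λ t →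
                                                               *-clear-≤ (H t) (A L i t) (y t) (0≤p⇒0≤q⇒0≤p*q (0≤A i t) (proj₁ (y∈I t))))) ⟩
      highCol i + sumFin n (λ t → A L i t * y t)          ≤⟨ q≤r-p⇒p+q≤r _ _ _ (y-rows i) ⟩
      b L i                                               ∎

mainTheorem11 : (k n : ℕ) (L : PackingLP (suc k) n) → WellFormed L →
    (∀ i → 0ℚ < b L i) →
    (opt : ℚ) → IsOPT L opt →
    (τ : ℚ) → 0ℚ ≤ τ → opt ≤ τ * minFin k (b L) →
    IsOPT (skim τ L) (opt - highValue τ L)
mainTheorem11 k n L (_ , A∈I , _) 0<b opt opt-L τ _ opt≤τβ =
  IsOPT-skim L τ (λ i t → proj₁ (A∈I i t)) opt-L high-saturated
  where
  β = minFin k (b L)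
  0<β : 0ℚ < β
  0<β = let (i , β≡bᵢ) = minFin-attained k (b L) in subst (0ℚ <_) (sym β≡bᵢ) (0<b i)
  high-saturated : ∀ t → T (isHigh τ L t) → proj₁ (proj₁ opt-L) t ≡ 1ℚ
  high-saturated t high = optimal⇒saturated L (λ i t → proj₂ (A∈I i t)) β 0<β (minFin-≤ k (b L)) opt-L t
    (begin-strict
      opt        ≤⟨ opt≤τβ ⟩
      τ * β      ≡⟨ *-comm τ β ⟩
      β * τ      <⟨ *-monoʳ-<-pos β {{positive 0<β}} τ<πₜ ⟩
      β * π L t  ∎)
    where
    open ≤-Reasoning
    τ<πₜ : τ < π L t
    τ<πₜ = toWitness (subst T (sym (isYes≗does (τ <? π L t))) high)
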